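{- Let $G=(V,E)$ be a graph that admits an optimal order. Then $\delta_G(i+1)-\delta_G(i)\leq 1$ for all $i\in\{1,\dots,|V|-1\}$.
   Context: For a graph $G=(V,E)$ and $A\subseteq V$, let $I(A)$ be the set of edges with both endpoints in $A$, and $I(m)=\max_{A\subseteq V,|A|=m}|I(A)|$. A set $A$ with $|A|=m$ is optimal if $|I(A)|=I(m)$. An optimal order (nested solutions) is a total order on $V$ each of whose initial segments is an optimal set. The $\delta$-sequence is $\delta_G=(\delta_G(1),\dots,\delta_G(|V|))$ with $\delta_G(1)=0$ and $\delta_G(m)=I(m)-I(m-1)$ for $m\geq 2$. -}

module Defs where

open import Data.Bool using (Bool; true; false; _∧_)
open import Data.Nat using (ℕ; zero; suc; _+_; _⊔_; _<ᵇ_)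
open import Data.Fin using (Fin; toℕ)
open import Data.Fin.Subset using (Subset; ∣_∣; _∈_)
open import Data.Fin.Permutation using (Permutation′; _⟨$⟩ʳ_; _⟨$⟩ˡ_)
open import Data.List using (List; []; _∷_; _++_; map; foldr; filterᵇ; allFin)
open import Data.Nat.ListAction using (sum)
open import Data.Vec using (Vec; []; _∷_; lookup; tabulate)
open import Data.Integer using (ℤ; _⊖_; 0ℤ)
open import Relation.Binary.PropositionalEquality using (_≡_)
open import Relation.Nullary using (¬_)

record Graph (n : ℕ) : Set where
  field
    adj    : Fin n → Fin n → Bool
    sym    : ∀ u v → adj u v ≡ adj v u
    irrefl : ∀ v → adj v v ≡ false
open Graph public

⟦_⟧ : Bool → ℕ
⟦ true ⟧  = 1
⟦ false ⟧ = 0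

edgesIn : ∀ {n} → Graph n → Subset n → ℕ
edgesIn {n} G A =
  sum (map (λ u → sum (map (λ v →
    ⟦ (toℕ u <ᵇ toℕ v) ∧ lookup A u ∧ lookup A v ∧ adj G u v ⟧)
    (allFin n))) (allFin n))

allSubsets : ∀ n → List (Subset n)
allSubsets zero    = [] ∷ []
allSubsets (suc n) = map (true ∷_) (allSubsets n) ++ map (false ∷_) (allSubsets n)

maximum : List ℕ → ℕ
maximum = foldr _⊔_ 0

Imax : ∀ {n} → Graph n → ℕ → ℕ
Imax {n} G m =
  maximum (map (edgesIn G) (filterᵇ (λ A → Data.Nat._≡ᵇ_ ∣ A ∣ m) (allSubsets n)))

Optimal : ∀ {n} → Graph n → Subset n → Set
Optimal G A = edgesIn G A ≡ Imax G ∣ A ∣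

-- initial segment of length k of the order given by the bijection σ : positions → vertices
-- (vertex v is in the segment iff its position σ⁻¹ v is < k)
initSeg : ∀ {n} → Permutation′ n → ℕ → Subset n
initSeg σ k = tabulate (λ v → toℕ (σ ⟨$⟩ˡ v) <ᵇ k)

OptimalOrder : ∀ {n} → Graph n → Permutation′ n → Set
OptimalOrder {n} G σ = ∀ k → k Data.Nat.≤ n → Optimal G (initSeg σ k)

HasOptimalOrder : ∀ {n} → Graph n → Set
HasOptimalOrder {n} G = Data.Product.Σ (Permutation′ n) (OptimalOrder G)
  where import Data.Product

-- δ-sequence: δ(1) = 0, δ(m) = I(m) - I(m-1) for m ≥ 2 (δ(0) unused, set to 0)
δ : ∀ {n} → Graph n → ℕ → ℤ
δ G zero          = 0ℤ
δ G (suc zero)    = 0ℤ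
δ G (suc (suc m)) = Imax G (suc (suc m)) ⊖ Imax G (suc m)

-- Let v₀, v₁, … be an optimal order with initial segments Sₖ, and fix 1 ≤ i < |V|.
-- Put Y = Sᵢ and let B be Sᵢ with vᵢ₋₁ replaced by vᵢ, i.e. the i-th initial segment
-- of the order with vᵢ₋₁ and vᵢ swapped. Then Y ∪ B = Sᵢ₊₁ and Y ∩ B = Sᵢ₋₁, and
-- counting edges pair by pair gives the modular identity
--   |I(Y ∪ B)| + |I(Y ∩ B)| = |I(Y)| + |I(B)| + e(Y ∖ B, B ∖ Y),
-- where the last term is at most 1 because Y ∖ B = {vᵢ₋₁} and B ∖ Y = {vᵢ}.
-- Optimality of the segments and |B| = i turn this into I(i+1) + I(i−1) ≤ 2 I(i) + 1,
-- which is δ(i+1) − δ(i) ≤ 1.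

module Submission where

open import Defs hiding (sym)
open import Data.Nat using (ℕ; zero; suc; _+_; _≤_; _<_; _<ᵇ_; _≡ᵇ_; _⊓_; _⊔_; z≤n; s≤s)
open import Data.Nat.Properties hiding (_≟_)
open import Data.Integer using (_-_; _⊖_; 1ℤ)
open import Data.Integer as ℤ using ()
import Data.Integer.Properties as ℤ
open import Data.Integer.Tactic.RingSolver using (solve-∀)
open import Data.Bool using (Bool; true; false; T; not; _∧_; _∨_)
open import Data.Bool.Properties using (T-∧; ∨-idem; ∧-zeroʳ; ∧-identityʳ; ∧-idem; ∧-inverseʳ)
open import Data.Fin as Fin using (Fin; toℕ; fromℕ<; _≟_)
open import Data.Fin.Properties using (toℕ-injective; toℕ-fromℕ<)
open import Data.Fin.Subset using (Subset; ∣_∣; _∪_; _∩_; ∁)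
open import Data.Fin.Permutation as Perm using (Permutation′; _⟨$⟩ʳ_; _⟨$⟩ˡ_; _∘ₚ_)
import Data.Fin.Permutation.Components as PC
open import Data.List using (map; filterᵇ; allFin)
open import Data.List.Properties using (map-tabulate)
open import Data.List.Membership.Propositional using (_∈_)
open import Data.List.Membership.Propositional.Properties using (∈-map⁺; ∈-++⁺ˡ; ∈-++⁺ʳ)
open import Data.List.Relation.Unary.Any using (here; there)
import Data.List as List
open import Data.Nat.ListAction using () renaming (sum to listSum)
open import Data.Vec using (lookup; tabulate; []; _∷_)
open import Data.Vec.Properties using (lookup∘tabulate; tabulate∘lookup; tabulate-cong; lookup-zipWith; lookup-map)
open import Algebra.Properties.CommutativeMonoid.Sum +-0-commutativeMonoid
  using (sum; sum-syntax; ∑-distrib-+; sum-cong-≗; sum-replicate-zero; sum-permute)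
open import Data.Product using (_×_; _,_; proj₁)
open import Data.Unit using (tt)
open import Data.Empty using (⊥)
open import Function using (_∘_; Equivalence)
open import Relation.Binary.PropositionalEquality
open import Relation.Nullary using (Dec; yes; no; contradiction)
open import Relation.Binary using (tri<; tri≈; tri>)

open Equivalence using (to; from)

-- Boolean indicators

⟦⟧-mono : ∀ {x y} → (T x → T y) → ⟦ x ⟧ ≤ ⟦ y ⟧
⟦⟧-mono {false}          _ = z≤n
⟦⟧-mono {true}  {true}   _ = ≤-refl
⟦⟧-mono {true}  {false}  h = contradiction (h tt) λ ()

⟦⟧-+-≤ : ∀ {x y z} → (T x → T z) → (T y → T z) → (T x → T y → ⊥) → ⟦ x ⟧ + ⟦ y ⟧ ≤ ⟦ z ⟧
⟦⟧-+-≤ {true}  {true}  _  _  disjoint = contradiction tt (disjoint tt)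
⟦⟧-+-≤ {true}  {false} hx _  _   = ⟦⟧-mono hx
⟦⟧-+-≤ {false}         _  hy _   = ⟦⟧-mono hy

<ᵇ-true : ∀ {m n} → m < n → (m <ᵇ n) ≡ true
<ᵇ-true (s≤s z≤n)         = refl
<ᵇ-true (s≤s (s≤s m<n))   = <ᵇ-true (s≤s m<n)

<ᵇ-false : ∀ {m n} → n ≤ m → (m <ᵇ n) ≡ false
<ᵇ-false z≤n       = refl
<ᵇ-false (s≤s n≤m) = <ᵇ-false n≤m

<ᵇ-suc : ∀ {m n} → m ≢ n → (m <ᵇ suc n) ≡ (m <ᵇ n)
<ᵇ-suc {m} {n} m≢n with <-cmp m n
... | tri< m<n _ _ = trans (<ᵇ-true (m<n⇒m<1+n m<n)) (sym (<ᵇ-true m<n))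
... | tri≈ _ m≡n _ = contradiction m≡n m≢n
... | tri> _ _ n<m = trans (<ᵇ-false n<m) (sym (<ᵇ-false (<⇒≤ n<m)))

data Swapped (J t t′ : ℕ) : Set where
  first  : t ≡ J → t′ ≡ suc J → Swapped J t t′
  second : t ≡ suc J → t′ ≡ J → Swapped J t t′
  other  : t ≢ J → t ≢ suc J → t′ ≡ t → Swapped J t t′

module _ {J t t′ : ℕ} where

  swapped-∪ : Swapped J t t′ → (t <ᵇ suc (suc J)) ≡ (t <ᵇ suc J) ∨ (t′ <ᵇ suc J)
  swapped-∪ (first refl refl)
    rewrite <ᵇ-true (m<n⇒m<1+n (n<1+n J)) | <ᵇ-true (n<1+n J) = refl
  swapped-∪ (second refl refl)
    rewrite <ᵇ-true (n<1+n J) | <ᵇ-false (≤-refl {J}) = refl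
  swapped-∪ (other _ t≢1+J refl) rewrite <ᵇ-suc t≢1+J = sym (∨-idem _)

  swapped-∩ : Swapped J t t′ → (t <ᵇ J) ≡ (t <ᵇ suc J) ∧ (t′ <ᵇ suc J)
  swapped-∩ (first refl refl)
    rewrite <ᵇ-false (≤-refl {J}) = sym (∧-zeroʳ _)
  swapped-∩ (second refl refl)
    rewrite <ᵇ-false (≤-refl {J}) | <ᵇ-false (n≤1+n J) = refl
  swapped-∩ (other t≢J _ refl) rewrite <ᵇ-suc t≢J = sym (∧-idem _)

  swapped-onlyˡ : Swapped J t t′ → T ((t <ᵇ suc J) ∧ not (t′ <ᵇ suc J)) → t ≡ J
  swapped-onlyˡ (first refl refl) _ = refl
  swapped-onlyˡ (second refl refl) h rewrite <ᵇ-false (≤-refl {J}) = contradiction h λ ()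
  swapped-onlyˡ (other _ _ refl) h rewrite ∧-inverseʳ (t <ᵇ suc J) = contradiction h λ ()

  swapped-onlyʳ : Swapped J t t′ → T ((t′ <ᵇ suc J) ∧ not (t <ᵇ suc J)) → t ≡ suc J
  swapped-onlyʳ (first refl refl) h rewrite <ᵇ-false (≤-refl {J}) = contradiction h λ ()
  swapped-onlyʳ (second refl refl) _ = refl
  swapped-onlyʳ (other _ _ refl) h rewrite ∧-inverseʳ (t <ᵇ suc J) = contradiction h λ ()

module _ {n} (i j : Fin n) where

  transpose-at-i : PC.transpose i j i ≡ j
  transpose-at-i with i ≟ i
  ... | yes _   = refl
  ... | no i≢i  = contradiction refl i≢i

  transpose-at-j : PC.transpose i j j ≡ i
  transpose-at-j with j ≟ i
  ... | yes j≡i = j≡i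
  ... | no _ with j ≟ j
  ...   | yes _   = refl
  ...   | no j≢j  = contradiction refl j≢j

  transpose-fixed : ∀ {k} → k ≢ i → k ≢ j → PC.transpose i j k ≡ k
  transpose-fixed {k} k≢i k≢j with k ≟ i
  ... | yes k≡i = contradiction k≡i k≢i
  ... | no _ with k ≟ j
  ...   | yes k≡j = contradiction k≡j k≢j
  ...   | no _    = refl

swapped : ∀ {n J} {j₀ j₁ : Fin n} → toℕ j₀ ≡ J → toℕ j₁ ≡ suc J →
          ∀ k → Swapped J (toℕ k) (toℕ (PC.transpose j₁ j₀ k))
swapped {J = J} {j₀} {j₁} j₀≡J j₁≡1+J k = classify (k ≟ j₀) (k ≟ j₁)
  where
  classify : Dec (k ≡ j₀) → Dec (k ≡ j₁) → Swapped J (toℕ k) (toℕ (PC.transpose j₁ j₀ k))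
  classify (yes refl) _ = first j₀≡J (trans (cong toℕ (transpose-at-j j₁ j₀)) j₁≡1+J)
  classify _ (yes refl) = second j₁≡1+J (trans (cong toℕ (transpose-at-i j₁ j₀)) j₀≡J)
  classify (no k≢j₀) (no k≢j₁) =
    other (λ e → k≢j₀ (toℕ-injective (trans e (sym j₀≡J))))
          (λ e → k≢j₁ (toℕ-injective (trans e (sym j₁≡1+J))))
          (cong toℕ (transpose-fixed j₁ j₀ k≢j₁ k≢j₀))

-- Double sums over Fin n

∑-mono-≤ : ∀ {n} {f g : Fin n → ℕ} → (∀ i → f i ≤ g i) → sum f ≤ sum g
∑-mono-≤ {zero}  f≤g = z≤n
∑-mono-≤ {suc n} f≤g = +-mono-≤ (f≤g Fin.zero) (∑-mono-≤ (f≤g ∘ Fin.suc))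

∑-indicator-≡ᵇ : ∀ n m → ∑[ i < n ] ⟦ toℕ i ≡ᵇ m ⟧ ≤ 1
∑-indicator-≡ᵇ zero    m       = z≤n
∑-indicator-≡ᵇ (suc n) zero    = ≤-reflexive (cong suc (sum-replicate-zero n))
∑-indicator-≡ᵇ (suc n) (suc m) = ∑-indicator-≡ᵇ n m

∑-indicator-<ᵇ : ∀ {n m} → m ≤ n → ∑[ i < n ] ⟦ toℕ i <ᵇ m ⟧ ≡ m
∑-indicator-<ᵇ {n}     {zero}  _         = sum-replicate-zero n
∑-indicator-<ᵇ {suc n} {suc m} (s≤s m≤n) = cong suc (∑-indicator-<ᵇ m≤n)

listSum-map-allFin : ∀ n (f : Fin n → ℕ) → listSum (map f (allFin n)) ≡ sum f
listSum-map-allFin n f = trans (cong listSum (map-tabulate (λ i → i) f)) (go n f)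
  where
  go : ∀ n (f : Fin n → ℕ) → listSum (List.tabulate f) ≡ sum f
  go zero    f = refl
  go (suc n) f = cong (f Fin.zero +_) (go n (f ∘ Fin.suc))

pairSum : ∀ {n} → (Fin n → Fin n → ℕ) → ℕ
pairSum {n} f = ∑[ u < n ] ∑[ v < n ] f u v

pairSum-+ : ∀ {n} (f g : Fin n → Fin n → ℕ) →
            pairSum (λ u v → f u v + g u v) ≡ pairSum f + pairSum g
pairSum-+ {n} f g = trans (sum-cong-≗ {n} (λ u → ∑-distrib-+ (f u) (g u)))
                          (∑-distrib-+ (λ u → ∑[ v < n ] f u v) (λ u → ∑[ v < n ] g u v))

pairSum-mono-≤ : ∀ {n} {f g : Fin n → Fin n → ℕ} → (∀ u v → f u v ≤ g u v) → pairSum f ≤ pairSum g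
pairSum-mono-≤ f≤g = ∑-mono-≤ (λ u → ∑-mono-≤ (f≤g u))

pairSum-point : ∀ n a b → pairSum {n} (λ u v → ⟦ (toℕ u ≡ᵇ a) ∧ (toℕ v ≡ᵇ b) ⟧) ≤ 1
pairSum-point n a b = ≤-trans (∑-mono-≤ {n} row) (∑-indicator-≡ᵇ n a)
  where
  row : ∀ u → ∑[ v < n ] ⟦ (toℕ u ≡ᵇ a) ∧ (toℕ v ≡ᵇ b) ⟧ ≤ ⟦ toℕ u ≡ᵇ a ⟧
  row u with toℕ u ≡ᵇ a
  ... | true  = ∑-indicator-≡ᵇ n b
  ... | false = ≤-reflexive (sum-replicate-zero n)

-- Counting edges

edgeFromTo : ∀ {n} → Graph n → Subset n → Subset n → Fin n → Fin n → Bool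
edgeFromTo G P Q u v = (toℕ u <ᵇ toℕ v) ∧ lookup P u ∧ lookup Q v ∧ adj G u v

edgeIndicator : ∀ {n} → Graph n → Subset n → Subset n → Fin n → Fin n → ℕ
edgeIndicator G P Q u v = ⟦ edgeFromTo G P Q u v ⟧

edgeFromTo-ends : ∀ {n} (G : Graph n) P Q (u v : Fin n) → T (edgeFromTo G P Q u v) →
                  toℕ u < toℕ v × T (lookup P u) × T (lookup Q v)
edgeFromTo-ends G P Q u v uv with T-∧ .to uv
... | u<v , rest with T-∧ .to rest
...   | Pu , rest′ = <ᵇ⇒< (toℕ u) (toℕ v) u<v , Pu , proj₁ (T-∧ .to rest′)

edgesIn-pairSum : ∀ {n} (G : Graph n) (A : Subset n) → edgesIn G A ≡ pairSum (edgeIndicator G A A)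
edgesIn-pairSum {n} G A =
  trans (listSum-map-allFin n _) (sum-cong-≗ {n} (λ u → listSum-map-allFin n _))

edgesBetween : ∀ {n} → Graph n → Subset n → Subset n → ℕ
edgesBetween G P Q = pairSum (λ u v → edgeIndicator G P Q u v + edgeIndicator G Q P u v)

∧-∧-∧-comm : ∀ c x y a → c ∧ x ∧ y ∧ a ≡ (c ∧ a) ∧ x ∧ y
∧-∧-∧-comm false x y a     = refl
∧-∧-∧-comm true  x y true  = cong (x ∧_) (∧-identityʳ y)
∧-∧-∧-comm true  x y false = trans (cong (x ∧_) (∧-zeroʳ y)) (∧-zeroʳ x)

weighted-∪-∩ : ∀ k yu bu yv bv →
  ⟦ k ∧ (yu ∨ bu) ∧ (yv ∨ bv) ⟧ + ⟦ k ∧ (yu ∧ bu) ∧ (yv ∧ bv) ⟧ ≡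
  (⟦ k ∧ (yu ∧ not bu) ∧ (bv ∧ not yv) ⟧ + ⟦ k ∧ (bu ∧ not yu) ∧ (yv ∧ not bv) ⟧)
    + (⟦ k ∧ yu ∧ yv ⟧ + ⟦ k ∧ bu ∧ bv ⟧)
weighted-∪-∩ false _     _     _     _     = refl
weighted-∪-∩ true  true  true  true  true  = refl
weighted-∪-∩ true  true  true  true  false = refl
weighted-∪-∩ true  true  true  false true  = refl
weighted-∪-∩ true  true  true  false false = refl
weighted-∪-∩ true  true  false true  true  = refl
weighted-∪-∩ true  true  false true  false = refl
weighted-∪-∩ true  true  false false true  = refl
weighted-∪-∩ true  true  false false false = refl
weighted-∪-∩ true  false true  true  true  = refl
weighted-∪-∩ true  false true  true  false = refl
weighted-∪-∩ true  false true  false true  = refl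
weighted-∪-∩ true  false true  false false = refl
weighted-∪-∩ true  false false true  true  = refl
weighted-∪-∩ true  false false true  false = refl
weighted-∪-∩ true  false false false true  = refl
weighted-∪-∩ true  false false false false = refl

pair-∪-∩ : ∀ c yu bu yv bv a →
  ⟦ c ∧ (yu ∨ bu) ∧ (yv ∨ bv) ∧ a ⟧ + ⟦ c ∧ (yu ∧ bu) ∧ (yv ∧ bv) ∧ a ⟧ ≡
  (⟦ c ∧ (yu ∧ not bu) ∧ (bv ∧ not yv) ∧ a ⟧ + ⟦ c ∧ (bu ∧ not yu) ∧ (yv ∧ not bv) ∧ a ⟧)
    + (⟦ c ∧ yu ∧ yv ∧ a ⟧ + ⟦ c ∧ bu ∧ bv ∧ a ⟧)
pair-∪-∩ c yu bu yv bv a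
  rewrite ∧-∧-∧-comm c (yu ∨ bu) (yv ∨ bv) a | ∧-∧-∧-comm c (yu ∧ bu) (yv ∧ bv) a
        | ∧-∧-∧-comm c (yu ∧ not bu) (bv ∧ not yv) a | ∧-∧-∧-comm c (bu ∧ not yu) (yv ∧ not bv) a
        | ∧-∧-∧-comm c yu yv a | ∧-∧-∧-comm c bu bv a
  = weighted-∪-∩ (c ∧ a) yu bu yv bv

module _ {n} (p q : Subset n) (i : Fin n) where

  lookup-∪ : lookup (p ∪ q) i ≡ lookup p i ∨ lookup q i
  lookup-∪ = lookup-zipWith _∨_ i p q

  lookup-∩ : lookup (p ∩ q) i ≡ lookup p i ∧ lookup q i
  lookup-∩ = lookup-zipWith _∧_ i p q

  lookup-∩∁ : lookup (p ∩ ∁ q) i ≡ lookup p i ∧ not (lookup q i)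
  lookup-∩∁ = trans (lookup-zipWith _∧_ i p (∁ q)) (cong (lookup p i ∧_) (lookup-map i not q))

edgesIn-∪-∩ : ∀ {n} (G : Graph n) (Y B : Subset n) →
  edgesIn G (Y ∪ B) + edgesIn G (Y ∩ B) ≡ edgesBetween G (Y ∩ ∁ B) (B ∩ ∁ Y) + (edgesIn G Y + edgesIn G B)
edgesIn-∪-∩ {n} G Y B = begin
  edgesIn G (Y ∪ B) + edgesIn G (Y ∩ B)
    ≡⟨ cong₂ _+_ (edgesIn-pairSum G (Y ∪ B)) (edgesIn-pairSum G (Y ∩ B)) ⟩
  pairSum (e (Y ∪ B)) + pairSum (e (Y ∩ B))
    ≡⟨ pairSum-+ (e (Y ∪ B)) (e (Y ∩ B)) ⟨
  pairSum (λ u v → e (Y ∪ B) u v + e (Y ∩ B) u v)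
    ≡⟨ sum-cong-≗ {n} (λ u → sum-cong-≗ {n} (pointwise u)) ⟩
  pairSum (λ u v → crossing u v + (e Y u v + e B u v))
    ≡⟨ pairSum-+ crossing (λ u v → e Y u v + e B u v) ⟩
  edgesBetween G P Q + pairSum (λ u v → e Y u v + e B u v)
    ≡⟨ cong (edgesBetween G P Q +_) (pairSum-+ (e Y) (e B)) ⟩
  edgesBetween G P Q + (pairSum (e Y) + pairSum (e B))
    ≡⟨ cong (edgesBetween G P Q +_) (cong₂ _+_ (edgesIn-pairSum G Y) (edgesIn-pairSum G B)) ⟨
  edgesBetween G P Q + (edgesIn G Y + edgesIn G B) ∎
  where
  open ≡-Reasoning
  P Q : Subset n
  P = Y ∩ ∁ B
  Q = B ∩ ∁ Y

  e : Subset n → Fin n → Fin n → ℕ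
  e A = edgeIndicator G A A

  crossing : Fin n → Fin n → ℕ
  crossing u v = edgeIndicator G P Q u v + edgeIndicator G Q P u v

  pointwise : ∀ u v → e (Y ∪ B) u v + e (Y ∩ B) u v ≡ crossing u v + (e Y u v + e B u v)
  pointwise u v
    rewrite lookup-∪ Y B u | lookup-∪ Y B v | lookup-∩ Y B u | lookup-∩ Y B v
          | lookup-∩∁ Y B u | lookup-∩∁ Y B v | lookup-∩∁ B Y u | lookup-∩∁ B Y v
    = pair-∪-∩ (toℕ u <ᵇ toℕ v) (lookup Y u) (lookup B u) (lookup Y v) (lookup B v) (adj G u v)

edgesBetween-singletons : ∀ {n} (G : Graph n) (P Q : Subset n) {a b : Fin n} →
  (∀ u → T (lookup P u) → u ≡ a) → (∀ v → T (lookup Q v) → v ≡ b) → edgesBetween G P Q ≤ 1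
edgesBetween-singletons {n} G P Q {a} {b} P⊆a Q⊆b =
  ≤-trans (pairSum-mono-≤ pointwise) (pairSum-point n (toℕ a ⊓ toℕ b) (toℕ a ⊔ toℕ b))
  where
  -- the only pair u < v that can be counted is (min a b , max a b)
  target : Fin n → Fin n → Bool
  target u v = (toℕ u ≡ᵇ toℕ a ⊓ toℕ b) ∧ (toℕ v ≡ᵇ toℕ a ⊔ toℕ b)

  a<b⇒target : toℕ a < toℕ b → T (target a b)
  a<b⇒target a<b = T-∧ .from
    ( ≡⇒≡ᵇ _ _ (sym (m≤n⇒m⊓n≡m (<⇒≤ a<b))) , ≡⇒≡ᵇ _ _ (sym (m≤n⇒m⊔n≡n (<⇒≤ a<b))) )

  b<a⇒target : toℕ b < toℕ a → T (target b a)
  b<a⇒target b<a = T-∧ .from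
    ( ≡⇒≡ᵇ _ _ (sym (m≥n⇒m⊓n≡n (<⇒≤ b<a))) , ≡⇒≡ᵇ _ _ (sym (m≥n⇒m⊔n≡m (<⇒≤ b<a))) )

  pointwise : ∀ u v → edgeIndicator G P Q u v + edgeIndicator G Q P u v ≤ ⟦ target u v ⟧
  pointwise u v = ⟦⟧-+-≤ from-PQ from-QP disjoint
    where
    from-PQ : T (edgeFromTo G P Q u v) → T (target u v)
    from-PQ uv with edgeFromTo-ends G P Q u v uv
    ... | u<v , Pu , Qv with P⊆a u Pu | Q⊆b v Qv
    ...   | refl | refl = a<b⇒target u<v

    from-QP : T (edgeFromTo G Q P u v) → T (target u v)
    from-QP uv with edgeFromTo-ends G Q P u v uv
    ... | u<v , Qu , Pv with Q⊆b u Qu | P⊆a v Pv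
    ...   | refl | refl = b<a⇒target u<v

    disjoint : T (edgeFromTo G P Q u v) → T (edgeFromTo G Q P u v) → ⊥
    disjoint uv vu with edgeFromTo-ends G P Q u v uv | edgeFromTo-ends G Q P u v vu
    ... | u<v , _ , Qv | _ , Qu , _ = <-irrefl (cong toℕ (trans (Q⊆b u Qu) (sym (Q⊆b v Qv)))) u<v

edgesIn-subsingleton : ∀ {n} (G : Graph n) (A : Subset n) →
  (∀ u v → T (lookup A u) → T (lookup A v) → u ≡ v) → edgesIn G A ≡ 0
edgesIn-subsingleton {n} G A unique = n≤0⇒n≡0 (begin
  edgesIn G A                   ≡⟨ edgesIn-pairSum G A ⟩
  pairSum (edgeIndicator G A A) ≤⟨ pairSum-mono-≤ (λ u v → ⟦⟧-mono {y = false} (no-edge u v)) ⟩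
  pairSum {n} (λ _ _ → 0)       ≡⟨ trans (sum-cong-≗ {n} (λ _ → sum-replicate-zero n)) (sum-replicate-zero n) ⟩
  0                             ∎)
  where
  open ≤-Reasoning
  no-edge : ∀ u v → T (edgeFromTo G A A u v) → ⊥
  no-edge u v uv with edgeFromTo-ends G A A u v uv
  ... | u<v , Au , Av = <-irrefl (cong toℕ (unique u v Au Av)) u<v

-- Optimal sets and initial segments

≤-maximum-filterᵇ : ∀ {X : Set} (f : X → ℕ) (p : X → Bool) {x xs} → x ∈ xs → T (p x) →
                    f x ≤ maximum (map f (filterᵇ p xs))
≤-maximum-filterᵇ f p {x} (here refl) px with p x | px
... | true | _ = m≤m⊔n (f x) _
≤-maximum-filterᵇ f p {x} (there {y} x∈xs) px with p y
... | true  = ≤-trans (≤-maximum-filterᵇ f p x∈xs px) (m≤n⊔m (f y) _)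
... | false = ≤-maximum-filterᵇ f p x∈xs px

∈-allSubsets : ∀ {n} (A : Subset n) → A ∈ allSubsets n
∈-allSubsets {zero}  []            = here refl
∈-allSubsets {suc n} (true ∷ A)  = ∈-++⁺ˡ (∈-map⁺ (true ∷_) (∈-allSubsets A))
∈-allSubsets {suc n} (false ∷ A) = ∈-++⁺ʳ (map (true ∷_) (allSubsets n)) (∈-map⁺ (false ∷_) (∈-allSubsets A))

edgesIn≤Imax : ∀ {n} (G : Graph n) {A : Subset n} {m} → ∣ A ∣ ≡ m → edgesIn G A ≤ Imax G m
edgesIn≤Imax G {A} {m} ∣A∣≡m =
  ≤-maximum-filterᵇ (edgesIn G) (λ B → ∣ B ∣ ≡ᵇ m) (∈-allSubsets A) (≡⇒≡ᵇ ∣ A ∣ m ∣A∣≡m)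

∣tabulate∣ : ∀ {n} (f : Fin n → Bool) → ∣ tabulate f ∣ ≡ ∑[ i < n ] ⟦ f i ⟧
∣tabulate∣ {zero}  f = refl
∣tabulate∣ {suc n} f with f Fin.zero
... | true  = cong suc (∣tabulate∣ (f ∘ Fin.suc))
... | false = ∣tabulate∣ (f ∘ Fin.suc)

∣initSeg∣ : ∀ {n} (ρ : Permutation′ n) {k} → k ≤ n → ∣ initSeg ρ k ∣ ≡ k
∣initSeg∣ {n} ρ {k} k≤n = begin
  ∣ initSeg ρ k ∣                       ≡⟨ ∣tabulate∣ (λ u → toℕ (ρ ⟨$⟩ˡ u) <ᵇ k) ⟩
  ∑[ u < n ] ⟦ toℕ (ρ ⟨$⟩ˡ u) <ᵇ k ⟧  ≡⟨ sum-permute (λ i → ⟦ toℕ i <ᵇ k ⟧) (Perm.flip ρ) ⟨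
  ∑[ i < n ] ⟦ toℕ i <ᵇ k ⟧           ≡⟨ ∑-indicator-<ᵇ k≤n ⟩
  k                                     ∎
  where open ≡-Reasoning

lookup-initSeg : ∀ {n} (ρ : Permutation′ n) k u → lookup (initSeg ρ k) u ≡ (toℕ (ρ ⟨$⟩ˡ u) <ᵇ k)
lookup-initSeg ρ k = lookup∘tabulate (λ u → toℕ (ρ ⟨$⟩ˡ u) <ᵇ k)

initSeg-1-subsingleton : ∀ {n} (ρ : Permutation′ n) u v →
  T (lookup (initSeg ρ 1) u) → T (lookup (initSeg ρ 1) v) → u ≡ v
initSeg-1-subsingleton ρ u v u∈ v∈ = begin
  u                        ≡⟨ Perm.inverseʳ ρ ⟨
  ρ ⟨$⟩ʳ (ρ ⟨$⟩ˡ u)        ≡⟨ cong (ρ ⟨$⟩ʳ_) (toℕ-injective (trans (at-0 u u∈) (sym (at-0 v v∈)))) ⟩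
  ρ ⟨$⟩ʳ (ρ ⟨$⟩ˡ v)        ≡⟨ Perm.inverseʳ ρ ⟩
  v                        ∎
  where
  open ≡-Reasoning
  at-0 : ∀ w → T (lookup (initSeg ρ 1) w) → toℕ (ρ ⟨$⟩ˡ w) ≡ 0
  at-0 w w∈ = n<1⇒n≡0 (<ᵇ⇒< _ 1 (subst T (lookup-initSeg ρ 1 w) w∈))

optimal-initSeg : ∀ {n} (G : Graph n) σ → OptimalOrder G σ →
                  ∀ {k} → k ≤ n → edgesIn G (initSeg σ k) ≡ Imax G k
optimal-initSeg G σ opt k≤n = trans (opt _ k≤n) (cong (Imax G) (∣initSeg∣ σ k≤n))

module AdjacentSwap {n} (σ : Permutation′ n) (J : ℕ) (1+J<n : suc J < n) where

  J<n : J < n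
  J<n = <-trans (n<1+n J) 1+J<n

  j₀ j₁ : Fin n
  j₀ = fromℕ< J<n
  j₁ = fromℕ< 1+J<n

  σ′ : Permutation′ n
  σ′ = Perm.transpose j₀ j₁ ∘ₚ σ

  Y B : Subset n
  Y = initSeg σ (suc J)
  B = initSeg σ′ (suc J)

  private
    y b : Fin n → Bool
    y u = toℕ (σ ⟨$⟩ˡ u) <ᵇ suc J
    b u = toℕ (σ′ ⟨$⟩ˡ u) <ᵇ suc J

    lookup-Y : ∀ u → lookup Y u ≡ y u
    lookup-Y = lookup-initSeg σ (suc J)

    lookup-B : ∀ u → lookup B u ≡ b u
    lookup-B = lookup-initSeg σ′ (suc J)

    swapped-at : ∀ u → Swapped J (toℕ (σ ⟨$⟩ˡ u)) (toℕ (σ′ ⟨$⟩ˡ u))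
    swapped-at u = swapped (toℕ-fromℕ< J<n) (toℕ-fromℕ< 1+J<n) (σ ⟨$⟩ˡ u)

    initSeg-≡ : ∀ k A → (∀ u → (toℕ (σ ⟨$⟩ˡ u) <ᵇ k) ≡ lookup A u) → initSeg σ k ≡ A
    initSeg-≡ k A h = trans (tabulate-cong h) (tabulate∘lookup A)

    vertex-at : ∀ {j u} → toℕ (σ ⟨$⟩ˡ u) ≡ toℕ j → u ≡ σ ⟨$⟩ʳ j
    vertex-at eq = trans (sym (Perm.inverseʳ σ)) (cong (σ ⟨$⟩ʳ_) (toℕ-injective eq))

  initSeg-2+J : initSeg σ (suc (suc J)) ≡ Y ∪ B
  initSeg-2+J = initSeg-≡ (suc (suc J)) (Y ∪ B) λ u → trans (swapped-∪ (swapped-at u))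
    (sym (trans (lookup-∪ Y B u) (cong₂ _∨_ (lookup-Y u) (lookup-B u))))

  initSeg-J : initSeg σ J ≡ Y ∩ B
  initSeg-J = initSeg-≡ J (Y ∩ B) λ u → trans (swapped-∩ (swapped-at u))
    (sym (trans (lookup-∩ Y B u) (cong₂ _∧_ (lookup-Y u) (lookup-B u))))

  Y-only : ∀ u → T (lookup (Y ∩ ∁ B) u) → u ≡ σ ⟨$⟩ʳ j₀
  Y-only u h = vertex-at (trans (swapped-onlyˡ (swapped-at u) (subst T y∧¬b h)) (sym (toℕ-fromℕ< J<n)))
    where
    y∧¬b : lookup (Y ∩ ∁ B) u ≡ y u ∧ not (b u)
    y∧¬b = trans (lookup-∩∁ Y B u) (cong₂ (λ p q → p ∧ not q) (lookup-Y u) (lookup-B u))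

  B-only : ∀ u → T (lookup (B ∩ ∁ Y) u) → u ≡ σ ⟨$⟩ʳ j₁
  B-only u h = vertex-at (trans (swapped-onlyʳ (swapped-at u) (subst T b∧¬y h)) (sym (toℕ-fromℕ< 1+J<n)))
    where
    b∧¬y : lookup (B ∩ ∁ Y) u ≡ b u ∧ not (y u)
    b∧¬y = trans (lookup-∩∁ B Y u) (cong₂ (λ p q → p ∧ not q) (lookup-B u) (lookup-Y u))

  second-difference : ∀ (G : Graph n) → OptimalOrder G σ →
    Imax G (suc (suc J)) + Imax G J ≤ 1 + (Imax G (suc J) + edgesIn G B)
  second-difference G opt = begin
    Imax G (suc (suc J)) + Imax G J
      ≡⟨ cong₂ _+_ (optimal-initSeg G σ opt 1+J<n) (optimal-initSeg G σ opt (<⇒≤ J<n)) ⟨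
    edgesIn G (initSeg σ (suc (suc J))) + edgesIn G (initSeg σ J)
      ≡⟨ cong₂ (λ X W → edgesIn G X + edgesIn G W) initSeg-2+J initSeg-J ⟩
    edgesIn G (Y ∪ B) + edgesIn G (Y ∩ B)
      ≡⟨ edgesIn-∪-∩ G Y B ⟩
    edgesBetween G (Y ∩ ∁ B) (B ∩ ∁ Y) + (edgesIn G Y + edgesIn G B)
      ≤⟨ +-mono-≤ (edgesBetween-singletons G (Y ∩ ∁ B) (B ∩ ∁ Y) Y-only B-only)
                  (≤-reflexive (cong (_+ edgesIn G B) (optimal-initSeg G σ opt (<⇒≤ 1+J<n)))) ⟩
    1 + (Imax G (suc J) + edgesIn G B) ∎
    where open ≤-Reasoning

[x⊖y]-[z⊖w]≤1 : ∀ x y z w → x + w ≤ 1 + (y + z) → ((x ⊖ y) - (z ⊖ w)) ℤ.≤ 1ℤ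
[x⊖y]-[z⊖w]≤1 x y z w x+w≤1+y+z = begin
  (x ⊖ y) - (z ⊖ w)                        ≡⟨ cong₂ _-_ (ℤ.m-n≡m⊖n x y) (ℤ.m-n≡m⊖n z w) ⟨
  (ℤ.+ x - ℤ.+ y) - (ℤ.+ z - ℤ.+ w)        ≡⟨ rearrange (ℤ.+ x) (ℤ.+ y) (ℤ.+ z) (ℤ.+ w) ⟩
  (ℤ.+ x ℤ.+ ℤ.+ w) - (ℤ.+ y ℤ.+ ℤ.+ z)    ≡⟨ cong₂ _-_ (ℤ.pos-+ x w) (ℤ.pos-+ y z) ⟨
  ℤ.+ (x + w) - ℤ.+ (y + z)                ≡⟨ ℤ.m-n≡m⊖n (x + w) (y + z) ⟩
  (x + w) ⊖ (y + z)                        ≤⟨ ℤ.⊖-monoˡ-≤ (y + z) x+w≤1+y+z ⟩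
  suc (y + z) ⊖ (y + z)                    ≡⟨ 1+m⊖m (y + z) ⟩
  1ℤ                                       ∎
  where
  open ℤ.≤-Reasoning
  rearrange : ∀ (X Y Z W : ℤ.ℤ) → (X - Y) - (Z - W) ≡ (X ℤ.+ W) - (Y ℤ.+ Z)
  rearrange = solve-∀
  1+m⊖m : ∀ m → suc m ⊖ m ≡ 1ℤ
  1+m⊖m m = trans (ℤ.⊖-≥ (n≤1+n m)) (cong ℤ.+_ (m+n∸n≡m 1 m))

lemma1 : ∀ {n} (G : Graph n) → HasOptimalOrder G →
    ∀ i → 1 ≤ i → i < n → (δ G (suc i) - δ G i) ℤ.≤ 1ℤ
-- δ 1 is 0 by definition rather than I(1) − I(0); for i = 1 the set B is a single vertex.
lemma1 G (σ , opt) (suc zero) _ 1<n = [x⊖y]-[z⊖w]≤1 (Imax G 2) (Imax G 1) 0 0 (begin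
  Imax G 2 + 0                        ≤⟨ +-monoʳ-≤ (Imax G 2) z≤n ⟩
  Imax G 2 + Imax G 0                 ≤⟨ second-difference G opt ⟩
  1 + (Imax G 1 + edgesIn G B)        ≡⟨ cong (λ e → 1 + (Imax G 1 + e))
                                          (edgesIn-subsingleton G B (initSeg-1-subsingleton σ′)) ⟩
  1 + (Imax G 1 + 0)                  ∎)
  where
  open AdjacentSwap σ 0 1<n
  open ≤-Reasoning
lemma1 G (σ , opt) (suc (suc J)) _ 2+J<n =
  [x⊖y]-[z⊖w]≤1 (Imax G (3 + J)) (Imax G (2 + J)) (Imax G (2 + J)) (Imax G (1 + J)) (begin
    Imax G (3 + J) + Imax G (1 + J)       ≤⟨ second-difference G opt ⟩
    1 + (Imax G (2 + J) + edgesIn G B)    ≤⟨ +-monoʳ-≤ 1 (+-monoʳ-≤ (Imax G (2 + J))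
                                               (edgesIn≤Imax G {B} (∣initSeg∣ σ′ (<⇒≤ 2+J<n)))) ⟩
    1 + (Imax G (2 + J) + Imax G (2 + J)) ∎)
  where
  open AdjacentSwap σ (suc J) 2+J<n
  open ≤-Reasoning
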